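{- Let $G$ be the comparability graph of a finite poset $P$. Then every weak order $W$ extending $P$ satisfies $H(W)\ge H_\chi(G)$.
   Context: Logarithms are base 2. For a poset $Q$ on $n$ elements, $H(Q):=\min_{x\in\mathrm{STAB}(G(Q))}-\frac1n\sum_v\log x_v$, where $G(Q)$ is the comparability graph and $\mathrm{STAB}$ is the convex hull of the characteristic vectors of stable sets. A weak order is a poset whose comparability graph is complete multipartite; $W$ extends $P$ if they share the ground set and $v\leqslant_P w$ implies $v\leqslant_W w$. For a graph $G$ on $n$ vertices, the entropy of a coloring (partition into stable sets) $C_1,\dots,C_\ell$ is $-\sum_{i}\frac{|C_i|}{n}\log\frac{|C_i|}{n}$, and the chromatic entropy $H_\chi(G)$ is the minimum entropy of a coloring of $G$.
   Formalization: The minimum defining H(W) is taken only over points of STAB with rational coordinates, given as convex combinations of stable-set vectors with rational coefficients. -}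

module Defs where

open import Data.Nat as ℕ using (ℕ; zero; suc; _^_)
open import Data.Fin using (Fin; zero; suc; _≟_)
open import Data.Fin.Subset using (Subset; _∈_)
open import Data.Vec using (lookup)
open import Data.Bool using (Bool; true; false; if_then_else_)
open import Data.List using (List; []; _∷_)
open import Data.Product using (_×_; _,_; Σ; ∃)
open import Data.Sum using (_⊎_)
open import Data.Rational as ℚ using (ℚ; 0ℚ; 1ℚ)
open import Relation.Nullary using (¬_; does)
open import Relation.Binary.PropositionalEquality using (_≡_; _≢_)
open import Relation.Binary.Structures using (IsPartialOrder)
open import Level using (0ℓ)

record FinPoset (n : ℕ) : Set₁ where
  field
    _≼_ : Fin n → Fin n → Set
    isPartialOrder : IsPartialOrder _≡_ _≼_

open FinPoset public

CompAdj : ∀ {n} → FinPoset n → Fin n → Fin n → Set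
CompAdj Q u v = u ≢ v × (_≼_ Q u v ⊎ _≼_ Q v u)

CompleteMultipartite : ∀ {n} → (Fin n → Fin n → Set) → Set
CompleteMultipartite {n} Adj =
  Σ ℕ λ k → Σ (Fin n → Fin k) λ part →
    ∀ u v → (Adj u v → part u ≢ part v) × (part u ≢ part v → Adj u v)

IsWeakOrder : ∀ {n} → FinPoset n → Set
IsWeakOrder W = CompleteMultipartite (CompAdj W)

Extends : ∀ {n} → FinPoset n → FinPoset n → Set
Extends {n} P W = ∀ (v w : Fin n) → _≼_ P v w → _≼_ W v w

Stable : ∀ {n} → (Fin n → Fin n → Set) → Subset n → Set
Stable Adj S = ∀ u v → u ∈ S → v ∈ S → ¬ Adj u v

indicator : ∀ {n} → Subset n → Fin n → ℚ
indicator S v = if lookup S v then 1ℚ else 0ℚ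

-- A convex combination of stable sets: a list of (coefficient, stable set).
sumCoeffs : ∀ {n} → List (ℚ × Subset n) → ℚ
sumCoeffs [] = 0ℚ
sumCoeffs ((λ₀ , _) ∷ cs) = λ₀ ℚ.+ sumCoeffs cs

combination : ∀ {n} → List (ℚ × Subset n) → Fin n → ℚ
combination [] v = 0ℚ
combination ((λ₀ , S) ∷ cs) v = λ₀ ℚ.* indicator S v ℚ.+ combination cs v

data AllValid {n} (Adj : Fin n → Fin n → Set) : List (ℚ × Subset n) → Set where
  []  : AllValid Adj []
  _∷_ : ∀ {λ₀ S cs} → (0ℚ ℚ.≤ λ₀) × Stable Adj S → AllValid Adj cs →
        AllValid Adj ((λ₀ , S) ∷ cs)

InSTAB : ∀ {n} → (Fin n → Fin n → Set) → (Fin n → ℚ) → Set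
InSTAB {n} Adj x = Σ (List (ℚ × Subset n)) λ cs →
  AllValid Adj cs × sumCoeffs cs ≡ 1ℚ × (∀ v → x v ≡ combination cs v)

∏ℚ : ∀ {n} → (Fin n → ℚ) → ℚ
∏ℚ {zero} f = 1ℚ
∏ℚ {suc n} f = f zero ℚ.* ∏ℚ (λ i → f (suc i))

∏ℕ : ∀ {k} → (Fin k → ℕ) → ℕ
∏ℕ {zero} f = 1
∏ℕ {suc k} f = f zero ℕ.* ∏ℕ (λ i → f (suc i))

count : ∀ {n} → (Fin n → Bool) → ℕ
count {zero} p = 0
count {suc n} p = (if p zero then 1 else 0) ℕ.+ count (λ i → p (suc i))

-- A coloring of G with k (possibly empty) color classes.
IsColoring : ∀ {n k} → (Fin n → Fin n → Set) → (Fin n → Fin k) → Set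
IsColoring {n} Adj c = ∀ (u v : Fin n) → Adj u v → c u ≢ c v

classSize : ∀ {n k} → (Fin n → Fin k) → Fin k → ℕ
classSize c j = count (λ v → does (c v ≟ j))

-- colorWeight c = ∏_j |C_j|^{|C_j|}.  With n vertices the entropy of the
-- coloring is  log n − (1/n) log (colorWeight c).
colorWeight : ∀ {n k} → (Fin n → Fin k) → ℕ
colorWeight c = ∏ℕ (λ j → classSize c j ^ classSize c j)

module Submission where

-- The colouring is the partition of W into its parts: elements comparable in P are
-- comparable in W, hence lie in different parts. Give each vertex v the weight
-- 1/|C(v)| of its part. A stable set of the complete multipartite graph G(W) lies
-- inside one part, so it has total weight ≤ 1, and by convexity so does every
-- x ∈ STAB(G(W)): Σ_v x_v/|C(v)| ≤ 1. AM-GM, proved by induction from Bernoulli's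
-- inequality, turns this into n^n ∏_v x_v/|C(v)| ≤ 1, and ∏_v |C(v)| = ∏_j |C_j|^|C_j|.

open import Defs
open import Data.Nat using (ℕ; _^_)
open import Data.Fin using (Fin)
open import Data.Product using (Σ; _×_)
open import Data.Rational using (ℚ; _*_; _≤_)
open import Data.Rational using (_/_)
open import Data.Integer using (+_)

open import Algebra.Bundles using (CommutativeSemiring; CommutativeRing; CommutativeMonoid)
open import Data.Bool using (Bool; true; false; if_then_else_)
open import Data.Fin using (zero; suc; _≟_)
open import Data.Fin.Properties using (any?)
open import Data.Fin.Subset using (_∈_)
open import Data.Fin.Subset.Properties using (_∈?_)
import Data.Integer as ℤ
import Data.Integer.Properties as ℤ
open import Data.List using (_∷_)
open import Data.Nat as ℕ using (zero; suc)
import Data.Nat.Coprimality as Coprimality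
import Data.Nat.Properties as ℕ
open import Data.Product using (_,_; proj₁; proj₂)
open import Data.Rational as ℚ using (0ℚ; 1ℚ; _+_; _-_; _<_; mkℚ)
import Data.Rational.Properties as ℚ
open import Data.Rational.Solver using (module +-*-Solver)
open import Data.Sum using (inj₁; inj₂)
open import Data.Vec using (lookup)
open import Data.Vec.Properties using (lookup⇒[]=)
open import Function using (_∘_)
open import Relation.Binary.PropositionalEquality
open import Relation.Nullary using (does; yes; no; contradiction)
open import Relation.Nullary.Decidable using (dec-true; decidable-stable)
import Algebra.Properties.CommutativeSemigroup ℕ.*-commutativeSemigroup as ℕ*
import Algebra.Properties.CommutativeSemigroup
  (CommutativeMonoid.commutativeSemigroup ℚ.*-1-commutativeMonoid) as ℚ*

∏ℕ-cong : ∀ {n} {f g : Fin n → ℕ} → (∀ i → f i ≡ g i) → ∏ℕ f ≡ ∏ℕ g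
∏ℕ-cong {zero}  f≡g = refl
∏ℕ-cong {suc n} f≡g = cong₂ ℕ._*_ (f≡g zero) (∏ℕ-cong (f≡g ∘ suc))

∏ℕ-distrib-* : ∀ {n} (f g : Fin n → ℕ) → ∏ℕ (λ i → f i ℕ.* g i) ≡ ∏ℕ f ℕ.* ∏ℕ g
∏ℕ-distrib-* {zero}  f g = refl
∏ℕ-distrib-* {suc n} f g = trans (cong (f zero ℕ.* g zero ℕ.*_) (∏ℕ-distrib-* (f ∘ suc) (g ∘ suc)))
  (ℕ*.interchange (f zero) (g zero) (∏ℕ (f ∘ suc)) (∏ℕ (g ∘ suc)))

∏ℕ-1 : ∀ n → ∏ℕ {n} (λ _ → 1) ≡ 1
∏ℕ-1 zero    = refl
∏ℕ-1 (suc n) = trans (ℕ.+-identityʳ _) (∏ℕ-1 n)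

δ : ∀ {k} → Fin k → Fin k → ℕ
δ i j = if does (i ≟ j) then 1 else 0

∏ℕ-^δ : ∀ {k} (i : Fin k) (f : Fin k → ℕ) → ∏ℕ (λ j → f j ^ δ i j) ≡ f i
∏ℕ-^δ {suc k} zero f = begin
  f zero ^ 1 ℕ.* ∏ℕ {k} (λ _ → 1) ≡⟨ cong (f zero ^ 1 ℕ.*_) (∏ℕ-1 k) ⟩
  f zero ^ 1 ℕ.* 1                ≡⟨ trans (ℕ.*-identityʳ _) (ℕ.*-identityʳ _) ⟩
  f zero                           ∎
  where open ≡-Reasoning
∏ℕ-^δ {suc k} (suc i) f = trans (ℕ.+-identityʳ _) (∏ℕ-^δ i (f ∘ suc))

∏ℕ-regroup : ∀ {n k} (p : Fin n → Fin k) (f : Fin k → ℕ) →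
  ∏ℕ (f ∘ p) ≡ ∏ℕ (λ j → f j ^ classSize p j)
∏ℕ-regroup {zero}  {k} p f = sym (∏ℕ-1 k)
∏ℕ-regroup {suc n} {k} p f = begin
  f (p zero) ℕ.* ∏ℕ (f ∘ p ∘ suc)
    ≡⟨ cong₂ ℕ._*_ (sym (∏ℕ-^δ (p zero) f)) (∏ℕ-regroup (p ∘ suc) f) ⟩
  ∏ℕ (λ j → f j ^ δ (p zero) j) ℕ.* ∏ℕ (λ j → f j ^ classSize (p ∘ suc) j)
    ≡⟨ sym (∏ℕ-distrib-* {k} _ _) ⟩
  ∏ℕ (λ j → f j ^ δ (p zero) j ℕ.* f j ^ classSize (p ∘ suc) j)
    ≡⟨ ∏ℕ-cong (λ j → sym (ℕ.^-distribˡ-+-* (f j) (δ (p zero) j) (classSize (p ∘ suc) j))) ⟩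
  ∏ℕ (λ j → f j ^ classSize p j) ∎
  where open ≡-Reasoning

open +-*-Solver
open ℚ.≤-Reasoning

ℚ-commutativeSemiring : CommutativeSemiring _ _
ℚ-commutativeSemiring = CommutativeRing.commutativeSemiring ℚ.+-*-commutativeRing

open import Algebra.Properties.CommutativeSemiring.Exp ℚ-commutativeSemiring
  using (^-distrib-*) renaming (_^_ to _^ℚ_)
open import Algebra.Properties.Semiring.Sum (CommutativeSemiring.semiring ℚ-commutativeSemiring)
  using (sum; sum-syntax; sum-cong-≗; ∑-distrib-+; *-distribˡ-sum; *-distribʳ-sum; sum-replicate-zero)

fromℕ : ℕ → ℚ
fromℕ m = + m / 1

-- m/1 in lowest terms; unlike fromℕ m it computes for variable m.
fromℕ-mkℚ : ℕ → ℚ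
fromℕ-mkℚ m = mkℚ (+ m) 0 (Coprimality.sym (Coprimality.1-coprimeTo m))

fromℕ≡mkℚ : ∀ m → fromℕ m ≡ fromℕ-mkℚ m
fromℕ≡mkℚ m = ℚ.normalize-coprime _

fromℕ-homo-+ : ∀ m n → fromℕ (m ℕ.+ n) ≡ fromℕ m + fromℕ n
fromℕ-homo-+ m n = begin-equality
  + (m ℕ.+ n) / 1
    ≡⟨ cong (_/ 1) (sym (cong₂ ℤ._+_ (ℤ.*-identityʳ (+ m)) (ℤ.*-identityʳ (+ n)))) ⟩
  (+ m ℤ.* + 1 ℤ.+ + n ℤ.* + 1) / 1
    -- the sum of the reduced fractions m/1 and n/1 computes to this normalisation
    ≡⟨ sym (cong₂ _+_ (fromℕ≡mkℚ m) (fromℕ≡mkℚ n)) ⟩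
  fromℕ m + fromℕ n ∎

fromℕ-homo-* : ∀ m n → fromℕ (m ℕ.* n) ≡ fromℕ m * fromℕ n
fromℕ-homo-* m n =
  trans (cong (_/ 1) (ℤ.pos-* m n)) (sym (cong₂ _*_ (fromℕ≡mkℚ m) (fromℕ≡mkℚ n)))

fromℕ-homo-^ : ∀ m k → fromℕ (m ^ k) ≡ fromℕ m ^ℚ k
fromℕ-homo-^ m zero    = refl
fromℕ-homo-^ m (suc k) = trans (fromℕ-homo-* m (m ^ k)) (cong (fromℕ m *_) (fromℕ-homo-^ m k))

fromℕ-nonNeg : ∀ m → 0ℚ ≤ fromℕ m
fromℕ-nonNeg m = subst (0ℚ ≤_) (sym (fromℕ≡mkℚ m)) (ℚ.nonNegative⁻¹ _)

fromℕ-pos : ∀ m → 0ℚ < fromℕ (suc m)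
fromℕ-pos m = subst (0ℚ <_) (sym (fromℕ≡mkℚ (suc m))) (ℚ.positive⁻¹ _)

*-nonNeg : ∀ {p q} → 0ℚ ≤ p → 0ℚ ≤ q → 0ℚ ≤ p * q
*-nonNeg {p} {q} 0≤p 0≤q =
  ℚ.nonNegative⁻¹ (p * q)
    {{ℚ.nonNeg*nonNeg⇒nonNeg p {{ℚ.nonNegative 0≤p}} q {{ℚ.nonNegative 0≤q}}}}

*-pos : ∀ {p q} → 0ℚ < p → 0ℚ < q → 0ℚ < p * q
*-pos {p} {q} 0<p 0<q =
  ℚ.positive⁻¹ (p * q) {{ℚ.pos*pos⇒pos p {{ℚ.positive 0<p}} q {{ℚ.positive 0<q}}}}

*-monoˡ-≤ : ∀ {r p q} → 0ℚ ≤ r → p ≤ q → r * p ≤ r * q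
*-monoˡ-≤ {r} 0≤r = ℚ.*-monoˡ-≤-nonNeg r {{ℚ.nonNegative 0≤r}}

*-monoʳ-≤ : ∀ {r p q} → 0ℚ ≤ r → p ≤ q → p * r ≤ q * r
*-monoʳ-≤ {r} 0≤r = ℚ.*-monoʳ-≤-nonNeg r {{ℚ.nonNegative 0≤r}}

*-cancelˡ-≤ : ∀ {r p q} → 0ℚ < r → r * p ≤ r * q → p ≤ q
*-cancelˡ-≤ {r} 0<r = ℚ.*-cancelˡ-≤-pos r {{ℚ.positive 0<r}}

≤-+-nonNeg : ∀ p {q} → 0ℚ ≤ q → p ≤ p + q
≤-+-nonNeg p {q} 0≤q = begin
  p      ≡⟨ sym (ℚ.+-identityʳ p) ⟩
  p + 0ℚ ≤⟨ ℚ.+-monoʳ-≤ p 0≤q ⟩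
  p + q  ∎

square-nonNeg : ∀ d → 0ℚ ≤ d * d
square-nonNeg d with ℚ.≤-total 0ℚ d
... | inj₁ 0≤d = *-nonNeg 0≤d 0≤d
... | inj₂ d≤0 = ℚ.nonNegative⁻¹ (d * d)
  {{ℚ.nonPos*nonPos⇒nonPos d {{ℚ.nonPositive d≤0}} d {{ℚ.nonPositive d≤0}}}}

^-nonNeg : ∀ {x} → 0ℚ ≤ x → ∀ m → 0ℚ ≤ x ^ℚ m
^-nonNeg 0≤x zero    = ℚ.nonNegative⁻¹ 1ℚ
^-nonNeg 0≤x (suc m) = *-nonNeg 0≤x (^-nonNeg 0≤x m)

^-pos : ∀ {x} → 0ℚ < x → ∀ m → 0ℚ < x ^ℚ m
^-pos 0<x zero    = ℚ.positive⁻¹ 1ℚ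
^-pos 0<x (suc m) = *-pos 0<x (^-pos 0<x m)

^-≤-1 : ∀ {x} → 0ℚ ≤ x → x ≤ 1ℚ → ∀ m → x ^ℚ m ≤ 1ℚ
^-≤-1 0≤x x≤1 zero    = ℚ.≤-refl
^-≤-1 {x} 0≤x x≤1 (suc m) = begin
  x * x ^ℚ m ≤⟨ *-monoˡ-≤ 0≤x (^-≤-1 0≤x x≤1 m) ⟩
  x * 1ℚ     ≡⟨ ℚ.*-identityʳ x ⟩
  x          ≤⟨ x≤1 ⟩
  1ℚ         ∎

fromℕ^self-pos : ∀ m → 0ℚ < fromℕ m ^ℚ m
fromℕ^self-pos zero    = ℚ.positive⁻¹ 1ℚ
fromℕ^self-pos (suc m) = ^-pos (fromℕ-pos m) (suc m)

bernoulli : ∀ m X d → 0ℚ ≤ X → 0ℚ ≤ X + d →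
  X ^ℚ suc m + fromℕ (suc m) * X ^ℚ m * d ≤ (X + d) ^ℚ suc m
bernoulli zero X d _ _ = ℚ.≤-reflexive
  (solve 2 (λ X d → X :* con 1ℚ :+ con 1ℚ :* con 1ℚ :* d := (X :+ d) :* con 1ℚ) refl X d)
bernoulli (suc m) X d 0≤X 0≤X+d = begin
  X ^ℚ suc (suc m) + fromℕ (suc (suc m)) * X ^ℚ suc m * d
    ≡⟨ cong (λ z → X ^ℚ suc (suc m) + z * X ^ℚ suc m * d) (fromℕ-homo-+ 1 (suc m)) ⟩
  X * (X * Y) + (1ℚ + c) * (X * Y) * d
    ≤⟨ ≤-+-nonNeg _ (*-nonNeg (*-nonNeg (fromℕ-nonNeg (suc m)) (^-nonNeg 0≤X m)) (square-nonNeg d)) ⟩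
  X * (X * Y) + (1ℚ + c) * (X * Y) * d + c * Y * (d * d)
    ≡⟨ solve 4 (λ X d Y c → X :* (X :* Y) :+ (con 1ℚ :+ c) :* (X :* Y) :* d :+ c :* Y :* (d :* d)
                  := (X :+ d) :* (X :* Y :+ c :* Y :* d)) refl X d Y c ⟩
  (X + d) * (X * Y + c * Y * d)
    ≤⟨ *-monoˡ-≤ 0≤X+d (bernoulli m X d 0≤X 0≤X+d) ⟩
  (X + d) * (X + d) ^ℚ suc m ∎
  where
  Y = X ^ℚ m
  c = fromℕ (suc m)

-- Bernoulli's inequality at X = (N+1) T and d = N b − T, where X + d = N (b + T).
am-gm-step : ∀ N b T → 0ℚ ≤ b → 0ℚ ≤ T →
  fromℕ (suc N) ^ℚ suc N * T ^ℚ N * b ≤ fromℕ N ^ℚ N * (b + T) ^ℚ suc N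
am-gm-step zero b T 0≤b 0≤T = begin
  fromℕ 1 ^ℚ 1 * T ^ℚ 0 * b ≡⟨ solve 1 (λ b → con 1ℚ :* con 1ℚ :* con 1ℚ :* b := b) refl b ⟩
  b                         ≤⟨ ≤-+-nonNeg b 0≤T ⟩
  b + T                     ≡⟨ solve 2 (λ b T → b :+ T := con 1ℚ :* ((b :+ T) :* con 1ℚ)) refl b T ⟩
  fromℕ 0 ^ℚ 0 * (b + T) ^ℚ 1 ∎
am-gm-step (suc M) b T 0≤b 0≤T = *-cancelˡ-≤ (fromℕ-pos M) (begin
  n * (c ^ℚ suc N * T ^ℚ N * b)                  ≡⟨ bernoulli-lhs ⟩
  X ^ℚ suc N + c * X ^ℚ N * d                    ≤⟨ bernoulli N X d 0≤X 0≤X+d ⟩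
  (X + d) ^ℚ suc N                               ≡⟨ cong (_^ℚ suc N) X+d≡ ⟩
  (n * (b + T)) ^ℚ suc N                         ≡⟨ ^-distrib-* n (b + T) (suc N) ⟩
  n * n ^ℚ N * (b + T) ^ℚ suc N                  ≡⟨ ℚ.*-assoc n _ _ ⟩
  n * (n ^ℚ N * (b + T) ^ℚ suc N)                ∎)
  where
  N = suc M
  n = fromℕ N
  c = fromℕ (suc N)
  X = c * T
  d = n * b - T
  c≡ : c ≡ 1ℚ + n
  c≡ = fromℕ-homo-+ 1 N
  X+d≡ : X + d ≡ n * (b + T)
  X+d≡ = trans (cong (λ z → z * T + d) c≡)
    (solve 3 (λ n b T → (con 1ℚ :+ n) :* T :+ (n :* b :- T) := n :* (b :+ T)) refl n b T)
  0≤X : 0ℚ ≤ X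
  0≤X = *-nonNeg (fromℕ-nonNeg (suc N)) 0≤T
  0≤X+d : 0ℚ ≤ X + d
  0≤X+d = subst (0ℚ ≤_) (sym X+d≡) (*-nonNeg (fromℕ-nonNeg N) (ℚ.+-mono-≤ 0≤b 0≤T))
  bernoulli-lhs : n * (c ^ℚ suc N * T ^ℚ N * b) ≡ X ^ℚ suc N + c * X ^ℚ N * d
  bernoulli-lhs = sym (trans (cong (λ P → X * P + c * P * d) (^-distrib-* c T N))
    (solve 6 (λ n c C D b T → (c :* T) :* (C :* D) :+ c :* (C :* D) :* (n :* b :- T)
                := n :* (c :* C :* D :* b)) refl n c (c ^ℚ N) (T ^ℚ N) b T))

sum-mono-≤ : ∀ {n} {f g : Fin n → ℚ} → (∀ i → f i ≤ g i) → sum f ≤ sum g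
sum-mono-≤ {zero}  f≤g = ℚ.≤-refl
sum-mono-≤ {suc n} f≤g = ℚ.+-mono-≤ (f≤g zero) (sum-mono-≤ (f≤g ∘ suc))

sum-nonNeg : ∀ {n} {f : Fin n → ℚ} → (∀ i → 0ℚ ≤ f i) → 0ℚ ≤ sum f
sum-nonNeg {n} {f} 0≤f = subst (_≤ sum f) (sum-replicate-zero n) (sum-mono-≤ {f = λ _ → 0ℚ} 0≤f)

am-gm : ∀ n (a : Fin n → ℚ) → (∀ i → 0ℚ ≤ a i) → fromℕ n ^ℚ n * ∏ℚ a ≤ sum a ^ℚ n
am-gm zero    a 0≤a = ℚ.≤-refl
am-gm (suc N) a 0≤a = *-cancelˡ-≤ (fromℕ^self-pos N) (begin
  D * (C * (b * P)) ≡⟨ solve 4 (λ D C b P → D :* (C :* (b :* P)) := (C :* b) :* (D :* P)) refl D C b P ⟩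
  C * b * (D * P)   ≤⟨ *-monoˡ-≤ (*-nonNeg (^-nonNeg (fromℕ-nonNeg (suc N)) (suc N)) (0≤a zero))
                                 (am-gm N (a ∘ suc) (0≤a ∘ suc)) ⟩
  C * b * T ^ℚ N    ≡⟨ solve 3 (λ C b Q → C :* b :* Q := C :* Q :* b) refl C b (T ^ℚ N) ⟩
  C * T ^ℚ N * b    ≤⟨ am-gm-step N b T (0≤a zero) (sum-nonNeg (0≤a ∘ suc)) ⟩
  D * (b + T) ^ℚ suc N ∎)
  where
  b = a zero
  T = sum (a ∘ suc)
  P = ∏ℚ (a ∘ suc)
  C = fromℕ (suc N) ^ℚ suc N
  D = fromℕ N ^ℚ N

∏ℚ-cong : ∀ {n} {f g : Fin n → ℚ} → (∀ i → f i ≡ g i) → ∏ℚ f ≡ ∏ℚ g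
∏ℚ-cong {zero}  f≡g = refl
∏ℚ-cong {suc n} f≡g = cong₂ _*_ (f≡g zero) (∏ℚ-cong (f≡g ∘ suc))

∏ℚ-distrib-* : ∀ {n} (f g : Fin n → ℚ) → ∏ℚ (λ i → f i * g i) ≡ ∏ℚ f * ∏ℚ g
∏ℚ-distrib-* {zero}  f g = refl
∏ℚ-distrib-* {suc n} f g = trans (cong (f zero * g zero *_) (∏ℚ-distrib-* (f ∘ suc) (g ∘ suc)))
  (ℚ*.interchange (f zero) (g zero) (∏ℚ (f ∘ suc)) (∏ℚ (g ∘ suc)))

fromℕ-homo-∏ : ∀ {k} (f : Fin k → ℕ) → fromℕ (∏ℕ f) ≡ ∏ℚ (fromℕ ∘ f)
fromℕ-homo-∏ {zero}  f = refl
fromℕ-homo-∏ {suc k} f =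
  trans (fromℕ-homo-* (f zero) (∏ℕ (f ∘ suc))) (cong (fromℕ (f zero) *_) (fromℕ-homo-∏ (f ∘ suc)))

fromBool : Bool → ℚ
fromBool b = if b then 1ℚ else 0ℚ

fromBool-nonNeg : ∀ b → 0ℚ ≤ fromBool b
fromBool-nonNeg true  = ℚ.nonNegative⁻¹ 1ℚ
fromBool-nonNeg false = ℚ.≤-refl

sum-fromBool : ∀ {n} (b : Fin n → Bool) → ∑[ i < n ] fromBool (b i) ≡ fromℕ (count b)
sum-fromBool {zero}  b = refl
sum-fromBool {suc n} b = begin-equality
  fromBool (b zero) + ∑[ i < n ] fromBool (b (suc i))
    ≡⟨ cong₂ _+_ (fromBool≡ (b zero)) (sum-fromBool (b ∘ suc)) ⟩
  fromℕ (if b zero then 1 else 0) + fromℕ (count (b ∘ suc))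
    ≡⟨ sym (fromℕ-homo-+ (if b zero then 1 else 0) (count (b ∘ suc))) ⟩
  fromℕ (count b) ∎
  where
  fromBool≡ : ∀ t → fromBool t ≡ fromℕ (if t then 1 else 0)
  fromBool≡ true  = refl
  fromBool≡ false = refl

count-suc : ∀ {n} (b : Fin n → Bool) v → b v ≡ true → Σ ℕ λ m → count b ≡ suc m
count-suc b zero    bv = count (b ∘ suc) , cong (λ t → (if t then 1 else 0) ℕ.+ count (b ∘ suc)) bv
count-suc b (suc v) bv with count-suc (b ∘ suc) v bv
... | m , eq = (if b zero then 1 else 0) ℕ.+ m , trans (cong ((if b zero then 1 else 0) ℕ.+_) eq) (ℕ.+-suc _ m)

-- 1/m in lowest terms, definitionally ℚ.1/ (fromℕ-mkℚ m); junk value recip 0 = 0.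
recip : ℕ → ℚ
recip zero    = 0ℚ
recip (suc m) = mkℚ (+ 1) m (Coprimality.1-coprimeTo (suc m))

recip-nonNeg : ∀ m → 0ℚ ≤ recip m
recip-nonNeg zero    = ℚ.≤-refl
recip-nonNeg (suc m) = ℚ.nonNegative⁻¹ (recip (suc m))

fromℕ*recip : ∀ m → fromℕ (suc m) * recip (suc m) ≡ 1ℚ
fromℕ*recip m = trans (cong (_* recip (suc m)) (fromℕ≡mkℚ (suc m))) (ℚ.*-inverseʳ (fromℕ-mkℚ (suc m)))

combination-nonNeg : ∀ {n} {Adj : Fin n → Fin n → Set} {L} → AllValid Adj L →
  ∀ v → 0ℚ ≤ combination L v
combination-nonNeg []                         v = ℚ.≤-refl
combination-nonNeg {L = (_ , S) ∷ _} ((0≤λ , _) ∷ valid) v =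
  ℚ.+-mono-≤ (*-nonNeg 0≤λ (fromBool-nonNeg (lookup S v))) (combination-nonNeg valid v)

stab-nonNeg : ∀ {n} {Adj : Fin n → Fin n → Set} {x} → InSTAB Adj x → ∀ v → 0ℚ ≤ x v
stab-nonNeg (_ , valid , _ , x≡) v = subst (0ℚ ≤_) (sym (x≡ v)) (combination-nonNeg valid v)

combination-weight-≤ : ∀ {n} {Adj : Fin n → Fin n → Set} (w : Fin n → ℚ) →
  (∀ S → Stable Adj S → ∑[ v < n ] (indicator S v * w v) ≤ 1ℚ) →
  ∀ {L} → AllValid Adj L → ∑[ v < n ] (combination L v * w v) ≤ sumCoeffs L
combination-weight-≤ {n} w _ [] = begin
  ∑[ v < n ] (0ℚ * w v) ≡⟨ sum-cong-≗ (λ v → ℚ.*-zeroˡ (w v)) ⟩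
  ∑[ v < n ] 0ℚ         ≡⟨ sum-replicate-zero n ⟩
  0ℚ                    ∎
combination-weight-≤ {n} w stable≤1 {(λ₀ , S) ∷ L} ((0≤λ , S-stable) ∷ valid) = begin
  ∑[ v < n ] ((λ₀ * indicator S v + combination L v) * w v)
    ≡⟨ sum-cong-≗ (λ v → ℚ.*-distribʳ-+ (w v) (λ₀ * indicator S v) (combination L v)) ⟩
  ∑[ v < n ] (λ₀ * indicator S v * w v + combination L v * w v)
    ≡⟨ ∑-distrib-+ (λ v → λ₀ * indicator S v * w v) (λ v → combination L v * w v) ⟩
  ∑[ v < n ] (λ₀ * indicator S v * w v) + ∑[ v < n ] (combination L v * w v)
    ≡⟨ cong (_+ ∑[ v < n ] (combination L v * w v))
         (trans (sum-cong-≗ (λ v → ℚ.*-assoc λ₀ (indicator S v) (w v)))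
                (sym (*-distribˡ-sum λ₀ (λ v → indicator S v * w v)))) ⟩
  λ₀ * ∑[ v < n ] (indicator S v * w v) + ∑[ v < n ] (combination L v * w v)
    ≤⟨ ℚ.+-mono-≤ (*-monoˡ-≤ 0≤λ (stable≤1 S S-stable))
                  (combination-weight-≤ w stable≤1 valid) ⟩
  λ₀ * 1ℚ + sumCoeffs L
    ≡⟨ cong (_+ sumCoeffs L) (ℚ.*-identityʳ λ₀) ⟩
  λ₀ + sumCoeffs L ∎

stab-weight-≤-1 : ∀ {n} {Adj : Fin n → Fin n → Set} (w : Fin n → ℚ) →
  (∀ S → Stable Adj S → ∑[ v < n ] (indicator S v * w v) ≤ 1ℚ) →
  ∀ {x} → InSTAB Adj x → ∑[ v < n ] (x v * w v) ≤ 1ℚ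
stab-weight-≤-1 {n} w stable≤1 {x} (L , valid , ∑λ≡1 , x≡) = begin
  ∑[ v < n ] (x v * w v)             ≡⟨ sum-cong-≗ (λ v → cong (_* w v) (x≡ v)) ⟩
  ∑[ v < n ] (combination L v * w v) ≤⟨ combination-weight-≤ w stable≤1 valid ⟩
  sumCoeffs L                        ≡⟨ ∑λ≡1 ⟩
  1ℚ                                 ∎

module _ {n k} {Adj : Fin n → Fin n → Set} (part : Fin n → Fin k)
         (apart⇒adjacent : ∀ u v → part u ≢ part v → Adj u v) where

  stable⇒samePart : ∀ {S} → Stable Adj S → ∀ {u v} → u ∈ S → v ∈ S → part u ≡ part v
  stable⇒samePart S-stable {u} {v} u∈S v∈S =
    decidable-stable (part u ≟ part v) (λ pu≢pv → S-stable u v u∈S v∈S (apart⇒adjacent u v pu≢pv))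

  classWeight : Fin n → ℚ
  classWeight v = recip (classSize part (part v))

  classWeight-nonNeg : ∀ v → 0ℚ ≤ classWeight v
  classWeight-nonNeg v = recip-nonNeg (classSize part (part v))

  classSize-suc : ∀ v → Σ ℕ λ m → classSize part (part v) ≡ suc m
  classSize-suc v = count-suc (λ u → does (part u ≟ part v)) v (dec-true (part v ≟ part v) refl)

  fromℕ-classSize*classWeight : ∀ v → fromℕ (classSize part (part v)) * classWeight v ≡ 1ℚ
  fromℕ-classSize*classWeight v with classSize part (part v) | classSize-suc v
  ... | _ | m , refl = fromℕ*recip m

  stable-classWeight-≤1 : ∀ S → Stable Adj S → ∑[ v < n ] (indicator S v * classWeight v) ≤ 1ℚ
  stable-classWeight-≤1 S S-stable with any? (_∈? S)
  ... | no S-empty = begin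
    ∑[ v < n ] (indicator S v * classWeight v) ≤⟨ sum-mono-≤ (λ v → outside-S v (lookup S v) refl) ⟩
    ∑[ v < n ] 0ℚ                              ≡⟨ sum-replicate-zero n ⟩
    0ℚ                                         ≤⟨ ℚ.nonNegative⁻¹ 1ℚ ⟩
    1ℚ                                         ∎
    where
    outside-S : ∀ v b → lookup S v ≡ b → fromBool b * classWeight v ≤ 0ℚ
    outside-S v true  v∈S = contradiction (v , lookup⇒[]= v S v∈S) S-empty
    outside-S v false _   = ℚ.≤-reflexive (ℚ.*-zeroˡ (classWeight v))
  ... | yes (u , u∈S) = begin
    ∑[ v < n ] (indicator S v * classWeight v)
      ≤⟨ sum-mono-≤ (λ v → within-class v (lookup S v) refl) ⟩
    ∑[ v < n ] (fromBool (inClass v) * classWeight u)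
      ≡⟨ sym (*-distribʳ-sum (classWeight u) (fromBool ∘ inClass)) ⟩
    ∑[ v < n ] fromBool (inClass v) * classWeight u
      ≡⟨ cong (_* classWeight u) (sum-fromBool inClass) ⟩
    fromℕ (classSize part (part u)) * classWeight u
      ≡⟨ fromℕ-classSize*classWeight u ⟩
    1ℚ ∎
    where
    inClass : Fin n → Bool
    inClass v = does (part v ≟ part u)
    within-class : ∀ v b → lookup S v ≡ b →
      fromBool b * classWeight v ≤ fromBool (inClass v) * classWeight u
    within-class v true v∈S with part v ≟ part u
    ... | yes pv≡pu = ℚ.≤-reflexive (cong (λ j → 1ℚ * recip (classSize part j)) pv≡pu)
    ... | no  pv≢pu = contradiction (stable⇒samePart S-stable (lookup⇒[]= v S v∈S) u∈S) pv≢pu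
    within-class v false _ = begin
      0ℚ * classWeight v                   ≡⟨ ℚ.*-zeroˡ (classWeight v) ⟩
      0ℚ                                   ≤⟨ *-nonNeg (fromBool-nonNeg (inClass v)) (classWeight-nonNeg u) ⟩
      fromBool (inClass v) * classWeight u ∎

  ∏ℚ-classWeight : ∀ x → ∏ℚ x ≡ ∏ℚ (λ v → x v * classWeight v) * fromℕ (colorWeight part)
  ∏ℚ-classWeight x = begin-equality
    ∏ℚ x                                      ≡⟨ ∏ℚ-cong x≡y*size ⟩
    ∏ℚ (λ v → y v * size v)                   ≡⟨ ∏ℚ-distrib-* y size ⟩
    ∏ℚ y * ∏ℚ size                            ≡⟨ cong (∏ℚ y *_) (sym (fromℕ-homo-∏ (classSize part ∘ part))) ⟩
    ∏ℚ y * fromℕ (∏ℕ (classSize part ∘ part)) ≡⟨ cong (λ m → ∏ℚ y * fromℕ m) (∏ℕ-regroup part (classSize part)) ⟩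
    ∏ℚ y * fromℕ (colorWeight part)           ∎
    where
    y size : Fin n → ℚ
    y v = x v * classWeight v
    size v = fromℕ (classSize part (part v))
    x≡y*size : ∀ v → x v ≡ y v * size v
    x≡y*size v = sym (begin-equality
      x v * classWeight v * size v   ≡⟨ ℚ.*-assoc (x v) (classWeight v) (size v) ⟩
      x v * (classWeight v * size v) ≡⟨ cong (x v *_) (ℚ.*-comm (classWeight v) (size v)) ⟩
      x v * (size v * classWeight v) ≡⟨ cong (x v *_) (fromℕ-classSize*classWeight v) ⟩
      x v * 1ℚ                       ≡⟨ ℚ.*-identityʳ (x v) ⟩
      x v                            ∎)

  stab-product-≤ : ∀ x → InSTAB Adj x → fromℕ (n ^ n) * ∏ℚ x ≤ fromℕ (colorWeight part)
  stab-product-≤ x x∈STAB = begin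
    fromℕ (n ^ n) * ∏ℚ x             ≡⟨ cong₂ _*_ (fromℕ-homo-^ n n) (∏ℚ-classWeight x) ⟩
    fromℕ n ^ℚ n * (∏ℚ y * fromℕ cw) ≡⟨ ℚ.*-assoc (fromℕ n ^ℚ n) (∏ℚ y) (fromℕ cw) ⟨
    fromℕ n ^ℚ n * ∏ℚ y * fromℕ cw   ≤⟨ *-monoʳ-≤ (fromℕ-nonNeg cw) (am-gm n y 0≤y) ⟩
    sum y ^ℚ n * fromℕ cw            ≤⟨ *-monoʳ-≤ (fromℕ-nonNeg cw) (^-≤-1 (sum-nonNeg 0≤y) ∑y≤1 n) ⟩
    1ℚ * fromℕ cw                    ≡⟨ ℚ.*-identityˡ (fromℕ cw) ⟩
    fromℕ cw                         ∎
    where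
    cw = colorWeight part
    y : Fin n → ℚ
    y v = x v * classWeight v
    0≤y : ∀ v → 0ℚ ≤ y v
    0≤y v = *-nonNeg (stab-nonNeg x∈STAB v) (classWeight-nonNeg v)
    ∑y≤1 : sum y ≤ 1ℚ
    ∑y≤1 = stab-weight-≤-1 classWeight stable-classWeight-≤1 x∈STAB

lemma5 : (n : ℕ) (P W : FinPoset n) → IsWeakOrder W → Extends P W →
    Σ ℕ λ k → Σ (Fin n → Fin k) λ c → IsColoring (CompAdj P) c ×
      (∀ (x : Fin n → ℚ) → InSTAB (CompAdj W) x →
        ((+ (n ^ n)) / 1) * ∏ℚ x ≤ ((+ colorWeight c) / 1))
lemma5 n P W (k , part , parts) P⊆W =
  k , part , colors-P , stab-product-≤ part (λ u v → proj₂ (parts u v))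
  where
  colors-P : IsColoring (CompAdj P) part
  colors-P u v (u≢v , inj₁ u≤v) = proj₁ (parts u v) (u≢v , inj₁ (P⊆W u v u≤v))
  colors-P u v (u≢v , inj₂ v≤u) = proj₁ (parts u v) (u≢v , inj₂ (P⊆W v u v≤u))
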